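{- Let $\pi\in{\cal S}_n$ be bi-increasing and $i\in[n]$. Then $i$ is a fixed point of $\pi$ (i.e. $\pi_i=i$) if and only if $\pi_j<\pi_i$ for all $j<i$ and $\pi_j>\pi_i$ for all $j>i$.
   Context: Permutations $\pi\in{\cal S}_n$ are written as words $\pi_1\cdots\pi_n$ with $\pi_i=\pi(i)$. An excedance of $\pi$ is an integer $i\in[n-1]$ with $\pi_i>i$; ${\sf E}(\pi)$ is the set of excedances. The excedance difference is ${\sf dexc}(\pi)=\sum_{i\in{\sf E}(\pi)}(\pi_i-i)$, and ${\sf inv}(\pi)$ is the number of pairs $i<j$ with $\pi_i>\pi_j$. A permutation $\pi$ is called bi-increasing if ${\sf inv}(\pi)={\sf dexc}(\pi)$. -}

module Defs where

open import Data.Nat using (ℕ; _+_; _∸_; _<ᵇ_)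
open import Data.Bool using (if_then_else_)
open import Data.Fin using (Fin; toℕ; _<_; _>_)
open import Data.Fin.Permutation using (Permutation′; _⟨$⟩ʳ_)
open import Data.List using (List; map; allFin)
open import Data.Nat.ListAction using (sum)
open import Relation.Binary.PropositionalEquality using (_≡_)

-- value π_i as a natural number (0-based; positions i are also 0-based,
-- i.e. Fin n represents [n] shifted by one, which does not affect
-- differences π_i - i or comparisons)
val : ∀ {n} → Permutation′ n → Fin n → ℕ
val π i = toℕ (π ⟨$⟩ʳ i)

-- contribution of position i to dexc: π_i - i if π_i > i, else 0
-- (truncated subtraction gives exactly this)
dexc : ∀ {n} → Permutation′ n → ℕ
dexc {n} π = sum (map (λ i → val π i ∸ toℕ i) (allFin n))

inv : ∀ {n} → Permutation′ n → ℕ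
inv {n} π =
  sum (map (λ i → sum (map (λ j →
        if (toℕ i <ᵇ toℕ j) then (if (val π j <ᵇ val π i) then 1 else 0) else 0)
      (allFin n))) (allFin n))

BiIncreasing : ∀ {n} → Permutation′ n → Set
BiIncreasing π = inv π ≡ dexc π

-- Every value π_a equals the number of positions b with π_b < π_a; those b lie either
-- before a (at most a of them) or after a, where they form inversions.  Hence
-- π_a − a ≤ #{b > a : π_b < π_a} for every a, and summing gives dexc π ≤ inv π.  So π is
-- bi-increasing exactly when all these inequalities are equalities.  At a fixed point i
-- the left side vanishes, so no later value lies below π_i; then the i values below π_i
-- must all sit at the i positions before i.  The converse holds for every permutation: under
-- the two conditions the values below π_i are exactly those at the i earlier positions.
module Submission where

open import Defs
open import Data.Nat using (ℕ; zero; suc; _+_; _∸_; _<ᵇ_; _≤_; z≤n)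
  renaming (_<_ to _<ℕ_)
open import Data.Nat.Properties
open import Data.Bool using (true; false; if_then_else_)
open import Data.Fin using (Fin; _<_; toℕ; zero; suc)
open import Data.Fin.Properties using (toℕ-injective)
open import Data.Fin.Permutation using (Permutation′; _⟨$⟩ʳ_; _⟨$⟩ˡ_; inverseˡ)
open import Data.Product using (_×_; _,_)
open import Data.List using (map; allFin; tabulate)
open import Data.List.Properties using (map-tabulate)
open import Data.Nat.ListAction using (sum)
open import Function.Base using (id; _∘_)
open import Function.Bundles using (_⇔_; mk⇔)
open import Relation.Binary.PropositionalEquality using (_≡_; refl; sym; trans; cong; module ≡-Reasoning)
open import Relation.Binary.Definitions using (tri<; tri≈; tri>)
open import Relation.Nullary using (yes; no; contradiction; ofʸ; ofⁿ)
open import Algebra.Properties.CommutativeMonoid.Sum +-0-commutativeMonoid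
  using (sum-syntax; sum-permute; sum-cong-≗; sum-replicate-zero; ∑-distrib-+)
  renaming (sum to ∑)

[_<_] : ℕ → ℕ → ℕ
[ m < n ] = if m <ᵇ n then 1 else 0

[<]≤1 : ∀ m n → [ m < n ] ≤ 1
[<]≤1 m n with m <ᵇ n
... | true  = ≤-refl
... | false = z≤n

[<]≡1 : ∀ {m n} → m <ℕ n → [ m < n ] ≡ 1
[<]≡1 {m} {n} m<n with m <ᵇ n | <ᵇ-reflects-< m n
... | true  | _        = refl
... | false | ofⁿ m≮n = contradiction m<n m≮n

[<]≡0 : ∀ {m n} → n ≤ m → [ m < n ] ≡ 0
[<]≡0 {m} {n} n≤m with m <ᵇ n | <ᵇ-reflects-< m n
... | true  | ofʸ m<n = contradiction m<n (≤⇒≯ n≤m)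
... | false | _       = refl

[<]≡1⇒< : ∀ {m n} → [ m < n ] ≡ 1 → m <ℕ n
[<]≡1⇒< {m} {n} eq with m <ᵇ n | <ᵇ-reflects-< m n
[<]≡1⇒< {m} {n} eq | true  | ofʸ m<n = m<n
[<]≡1⇒< {m} {n} () | false | _

[<]≡0⇒≥ : ∀ {m n} → [ m < n ] ≡ 0 → n ≤ m
[<]≡0⇒≥ {m} {n} eq with m <ᵇ n | <ᵇ-reflects-< m n
[<]≡0⇒≥ {m} {n} () | true  | _
[<]≡0⇒≥ {m} {n} eq | false | ofⁿ m≮n = ≮⇒≥ m≮n

+-mono-≤-≡⇒≡ : ∀ {a b c d} → a ≤ b → c ≤ d → a + c ≡ b + d → a ≡ b × c ≡ d
+-mono-≤-≡⇒≡ {a} {b} {c} {d} a≤b c≤d eq = a≡b , +-cancelˡ-≡ b c d (trans (cong (_+ c) (sym a≡b)) eq)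
  where
  open ≤-Reasoning
  a≡b : a ≡ b
  a≡b = ≤-antisym a≤b (+-cancelʳ-≤ d b a (begin
    b + d ≡⟨ sym eq ⟩
    a + c ≤⟨ +-monoʳ-≤ a c≤d ⟩
    a + d ∎))

sum-tabulate : ∀ {n} (f : Fin n → ℕ) → sum (tabulate f) ≡ ∑ f
sum-tabulate {zero}  f = refl
sum-tabulate {suc n} f = cong (f zero +_) (sum-tabulate (f ∘ suc))

sum-map-allFin : ∀ {n} (f : Fin n → ℕ) → sum (map f (allFin n)) ≡ ∑ f
sum-map-allFin f = trans (cong sum (map-tabulate id f)) (sum-tabulate f)

∑-mono-≤ : ∀ {n} {f g : Fin n → ℕ} → (∀ x → f x ≤ g x) → ∑ f ≤ ∑ g
∑-mono-≤ {zero}  f≤g = z≤n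
∑-mono-≤ {suc n} f≤g = +-mono-≤ (f≤g zero) (∑-mono-≤ (f≤g ∘ suc))

∑-mono-≤-≡⇒≗ : ∀ {n} {f g : Fin n → ℕ} → (∀ x → f x ≤ g x) → ∑ f ≡ ∑ g → ∀ x → f x ≡ g x
∑-mono-≤-≡⇒≗ {suc n} f≤g ∑≡ with +-mono-≤-≡⇒≡ (f≤g zero) (∑-mono-≤ (f≤g ∘ suc)) ∑≡
... | head≡ , tail≡ = λ { zero → head≡ ; (suc x) → ∑-mono-≤-≡⇒≗ (f≤g ∘ suc) tail≡ x }

∑≡0⇒≗0 : ∀ {n} {f : Fin n → ℕ} → ∑ f ≡ 0 → ∀ x → f x ≡ 0
∑≡0⇒≗0 {n} ∑≡0 x = sym (∑-mono-≤-≡⇒≗ (λ _ → z≤n) (trans (sum-replicate-zero n) (sym ∑≡0)) x)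

∑-[<] : ∀ {n} (c : Fin n) → ∑[ v < n ] [ toℕ v < toℕ c ] ≡ toℕ c
∑-[<] {suc n} zero    = sum-replicate-zero (suc n)
∑-[<] {suc n} (suc c) = cong suc (∑-[<] c)

∑-[<]-permute : ∀ {n} (π : Permutation′ n) (c : Fin n) → ∑[ b < n ] [ val π b < toℕ c ] ≡ toℕ c
∑-[<]-permute π c = trans (sym (sum-permute _ π)) (∑-[<] c)

module _ {n : ℕ} (π : Permutation′ n) where

  ⟨$⟩ʳ-injective : ∀ {a b} → π ⟨$⟩ʳ a ≡ π ⟨$⟩ʳ b → a ≡ b
  ⟨$⟩ʳ-injective {a} {b} eq = trans (sym (inverseˡ π)) (trans (cong (π ⟨$⟩ˡ_) eq) (inverseˡ π))

  excess : Fin n → ℕ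
  excess a = val π a ∸ toℕ a

  inversion : Fin n → Fin n → ℕ
  inversion a b = if toℕ a <ᵇ toℕ b then [ val π b < val π a ] else 0

  inversionsAt : Fin n → ℕ
  inversionsAt a = ∑[ b < n ] inversion a b

  dexc≡∑excess : dexc π ≡ ∑ excess
  dexc≡∑excess = sum-map-allFin excess

  inv≡∑inversionsAt : inv π ≡ ∑ inversionsAt
  inv≡∑inversionsAt = trans (sum-map-allFin {n} _) (sum-cong-≗ (λ a → sum-map-allFin (inversion a)))

  inversion-< : ∀ {a b} → a < b → inversion a b ≡ [ val π b < val π a ]
  inversion-< {a} {b} a<b with toℕ a <ᵇ toℕ b | <ᵇ-reflects-< (toℕ a) (toℕ b)
  ... | true  | _        = refl
  ... | false | ofⁿ a≮b = contradiction a<b a≮b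

  EarlierSmaller LaterLarger : Fin n → Set
  EarlierSmaller i = ∀ j → j < i → π ⟨$⟩ʳ j < π ⟨$⟩ʳ i
  LaterLarger    i = ∀ j → i < j → π ⟨$⟩ʳ i < π ⟨$⟩ʳ j

  [<]-≤-[<]+inversion : ∀ a b → [ val π b < val π a ] ≤ [ toℕ b < toℕ a ] + inversion a b
  [<]-≤-[<]+inversion a b with <-cmp (toℕ b) (toℕ a)
  ... | tri< b<a _ _ rewrite [<]≡1 b<a = ≤-trans ([<]≤1 (val π b) (val π a)) (m≤m+n 1 _)
  ... | tri≈ _ b≡a _ rewrite toℕ-injective b≡a | [<]≡0 (≤-refl {val π a}) = z≤n
  ... | tri> _ _ a<b rewrite inversion-< a<b = m≤n+m _ _

  excess≤inversionsAt : ∀ a → excess a ≤ inversionsAt a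
  excess≤inversionsAt a = m≤n+o⇒m∸n≤o (val π a) (toℕ a) (begin
    val π a                                              ≡⟨ sym (∑-[<]-permute π (π ⟨$⟩ʳ a)) ⟩
    ∑[ b < n ] [ val π b < val π a ]                     ≤⟨ ∑-mono-≤ ([<]-≤-[<]+inversion a) ⟩
    ∑[ b < n ] ([ toℕ b < toℕ a ] + inversion a b)       ≡⟨ ∑-distrib-+ (λ b → [ toℕ b < toℕ a ]) (inversion a) ⟩
    ∑[ b < n ] [ toℕ b < toℕ a ] + inversionsAt a        ≡⟨ cong (_+ inversionsAt a) (∑-[<] a) ⟩
    toℕ a + inversionsAt a                               ∎)
    where open ≤-Reasoning

  excess≡inversionsAt : BiIncreasing π → ∀ a → excess a ≡ inversionsAt a
  excess≡inversionsAt bi = ∑-mono-≤-≡⇒≗ excess≤inversionsAt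
    (trans (sym dexc≡∑excess) (trans (sym bi) inv≡∑inversionsAt))

  fixed⇒inversionsAt≡0 : BiIncreasing π → ∀ {i} → π ⟨$⟩ʳ i ≡ i → inversionsAt i ≡ 0
  fixed⇒inversionsAt≡0 bi {i} πi≡i = trans (sym (excess≡inversionsAt bi i))
    (trans (cong (λ v → toℕ v ∸ toℕ i) πi≡i) (n∸n≡0 (toℕ i)))

  inversionsAt≡0⇒laterLarger : ∀ {i} → inversionsAt i ≡ 0 → LaterLarger i
  inversionsAt≡0⇒laterLarger none j i<j = ≤∧≢⇒<
    ([<]≡0⇒≥ (trans (sym (inversion-< i<j)) (∑≡0⇒≗0 none j)))
    (λ πi≡πj → <⇒≢ i<j (cong toℕ (⟨$⟩ʳ-injective (toℕ-injective πi≡πj))))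

  laterLarger⇒[<]-≤ : ∀ {i} → LaterLarger i → ∀ b → [ val π b < val π i ] ≤ [ toℕ b < toℕ i ]
  laterLarger⇒[<]-≤ {i} later b with <-cmp (toℕ b) (toℕ i)
  ... | tri< b<i _ _ rewrite [<]≡1 b<i = [<]≤1 (val π b) (val π i)
  ... | tri≈ _ b≡i _ rewrite toℕ-injective b≡i | [<]≡0 (≤-refl {val π i}) = z≤n
  ... | tri> _ _ i<b rewrite [<]≡0 (<⇒≤ (later b i<b)) = z≤n

  earlierSmaller⇒[<]-≥ : ∀ {i} → EarlierSmaller i → ∀ b → [ toℕ b < toℕ i ] ≤ [ val π b < val π i ]
  earlierSmaller⇒[<]-≥ {i} earlier b with toℕ b <? toℕ i
  ... | yes b<i rewrite [<]≡1 (earlier b b<i) = [<]≤1 (toℕ b) (toℕ i)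
  ... | no  b≮i rewrite [<]≡0 (≮⇒≥ b≮i) = z≤n

  fixed∧laterLarger⇒earlierSmaller : ∀ {i} → π ⟨$⟩ʳ i ≡ i → LaterLarger i → EarlierSmaller i
  fixed∧laterLarger⇒earlierSmaller {i} πi≡i later j j<i = [<]≡1⇒< (trans (same-count j) ([<]≡1 j<i))
    where
    same-count : ∀ b → [ val π b < val π i ] ≡ [ toℕ b < toℕ i ]
    same-count = ∑-mono-≤-≡⇒≗ (laterLarger⇒[<]-≤ later)
      (trans (∑-[<]-permute π (π ⟨$⟩ʳ i)) (trans (cong toℕ πi≡i) (sym (∑-[<] i))))

  earlierSmaller∧laterLarger⇒fixed : ∀ {i} → EarlierSmaller i → LaterLarger i → π ⟨$⟩ʳ i ≡ i
  earlierSmaller∧laterLarger⇒fixed {i} earlier later = toℕ-injective (begin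
    val π i                              ≡⟨ sym (∑-[<]-permute π (π ⟨$⟩ʳ i)) ⟩
    ∑[ b < n ] [ val π b < val π i ]     ≡⟨ sum-cong-≗ same-count ⟩
    ∑[ b < n ] [ toℕ b < toℕ i ]         ≡⟨ ∑-[<] i ⟩
    toℕ i                                ∎)
    where
    open ≡-Reasoning
    same-count : ∀ b → [ val π b < val π i ] ≡ [ toℕ b < toℕ i ]
    same-count b = ≤-antisym (laterLarger⇒[<]-≤ later b) (earlierSmaller⇒[<]-≥ earlier b)

corollary2p5 : (n : ℕ) (π : Permutation′ n) → BiIncreasing π → (i : Fin n) →
    (π ⟨$⟩ʳ i ≡ i) ⇔
      (((j : Fin n) → j < i → π ⟨$⟩ʳ j < π ⟨$⟩ʳ i) ×
       ((j : Fin n) → i < j → π ⟨$⟩ʳ i < π ⟨$⟩ʳ j))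
corollary2p5 n π bi i =
  mk⇔ fixed⇒separated (λ (earlier , later) → earlierSmaller∧laterLarger⇒fixed π earlier later)
  where
  fixed⇒separated : π ⟨$⟩ʳ i ≡ i → EarlierSmaller π i × LaterLarger π i
  fixed⇒separated πi≡i = fixed∧laterLarger⇒earlierSmaller π πi≡i later , later
    where
    later : LaterLarger π i
    later = inversionsAt≡0⇒laterLarger π (fixed⇒inversionsAt≡0 π bi πi≡i)
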